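{- Let a finite group $\Gamma$ with $|\Gamma|\le k!$ act on a finite set $X$, and let $O$ be any orbit of this action. Then $O$ can be distinguished under the action of $\Gamma$ with at most $k$ labels, i.e. $D_\Gamma(O)\le k$.
   Context: For a group $\Gamma$ acting on a set $Y$, write $g.y$ for the action and $\mathrm{Stab}_\Gamma(Y)=\{g\in\Gamma: g.y=y \text{ for all } y\in Y\}$. A labelling $\phi:Y\to\{1,\dots,k\}$ is $k$-distinguishing if $\{g\in\Gamma:\phi(g.y)=\phi(y)\text{ for all }y\in Y\}=\mathrm{Stab}_\Gamma(Y)$. The distinguishing number $D_\Gamma(Y)$ is the minimum $k$ for which a $k$-distinguishing labelling exists. -}

module Defs where

open import Level using (Level; _⊔_)
open import Algebra.Bundles using (Group)
open import Data.Nat using (ℕ)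
open import Data.Fin using (Fin)
open import Data.Product using (∃)
open import Function.Bundles using (Inverse)
open import Relation.Binary.PropositionalEquality using (_≡_; setoid)

HasOrder : ∀ {c ℓ} → Group c ℓ → ℕ → Set (c ⊔ ℓ)
HasOrder Γ n = Inverse (setoid (Fin n)) (Group.setoid Γ)

record Action {c ℓ} (Γ : Group c ℓ) {x} (X : Set x) : Set (c ⊔ ℓ ⊔ x) where
  open Group Γ
  field
    act      : Carrier → X → X
    act-cong : ∀ {g h} → g ≈ h → ∀ y → act g y ≡ act h y
    act-id   : ∀ y → act ε y ≡ y
    act-comp : ∀ g h y → act (g ∙ h) y ≡ act g (act h y)

module _ {c ℓ x} {Γ : Group c ℓ} {X : Set x} (A : Action Γ X) where
  open Group Γ using (Carrier)
  open Action A

  InOrbit : X → X → Set (c ⊔ x)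
  InOrbit x₀ y = ∃ λ (g : Carrier) → act g x₀ ≡ y

  -- φ : O → {1..k} (given as a map on X, only its restriction to O = Γ.x₀
  -- matters) is k-distinguishing for O: every g preserving φ on O fixes O
  -- pointwise (the reverse inclusion Stab ⊆ {φ-preserving} is automatic).
  IsDistinguishingOnOrbit : (x₀ : X) {k : ℕ} → (X → Fin k) → Set (c ⊔ x)
  IsDistinguishingOnOrbit x₀ φ =
    ∀ (g : Carrier) →
      (∀ y → InOrbit x₀ y → φ (act g y) ≡ φ y) →
      ∀ y → InOrbit x₀ y → act g y ≡ y

  DistNumberOrbit≤ : (x₀ : X) → ℕ → Set (c ⊔ x)
  DistNumberOrbit≤ x₀ k = ∃ λ (φ : X → Fin k) → IsDistinguishingOnOrbit x₀ φ

{-# OPTIONS --safe #-}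
module Submission where

open import Defs
open import Algebra.Bundles using (Group)
open import Data.Nat using (ℕ; _≤_; _!)
open import Data.Fin using (Fin)

open import Level using (_⊔_; 0ℓ)
open import Data.Nat.Base using (zero; suc; _+_; _*_; z≤n; s≤s)
open import Data.Nat.Properties
  using (_≤?_; ≤-trans; ≤-reflexive; <⇒≤; ≰⇒>; *-comm; *-suc; *-zeroʳ; *-identityˡ; *-monoˡ-≤; *-monoʳ-≤; +-mono-≤; *-cancelˡ-≤; module ≤-Reasoning)
open import Data.Fin.Base using (zero; fromℕ; inject₁; inject≤)
open import Data.Fin.Properties using (_≟_; any?; inject≤-injective; inject₁-injective; fromℕ≢inject₁)
open import Data.List.Base using (List; []; _∷_; _++_; length; filter; map; allFin)
open import Data.List.Properties using (filter-notAll; length-filter; length-map; length-++; length-tabulate)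
open import Data.List.Relation.Unary.Any as Any using (here; there)
open import Data.List.Relation.Unary.All as All using (All; []; _∷_; all?)
import Data.List.Relation.Unary.All.Properties as All
open import Data.List.Relation.Unary.AllPairs using ([]; _∷_)
open import Data.List.Relation.Unary.Unique.Propositional using (Unique)
import Data.List.Relation.Unary.Unique.Propositional.Properties as Unique
open import Data.List.Relation.Binary.Subset.Propositional using (_⊆_)
open import Data.List.Membership.Propositional using (_∈_; _∉_)
open import Data.List.Membership.Propositional.Properties using (∈-filter⁺; ∈-filter⁻; ∈-allFin; ∈-map⁻; ∈-++⁻)
open import Data.List.Membership.Setoid.Properties using (index-injective)
open import Data.Product using (∃; _×_; _,_; proj₁; proj₂)
import Data.Product as Product
open import Data.Sum using (inj₁; inj₂)
open import Data.Empty using (⊥)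
open import Function using (_∘_; id)
open import Function.Bundles using (Inverse)
open import Function.Definitions using (Injective)
open import Relation.Nullary using (Dec; yes; no; contradiction; ¬?)
open import Relation.Nullary.Decidable using (_×-dec_; map′)
open import Relation.Unary using (Pred; Decidable)
open import Relation.Binary.Definitions using (DecidableEquality; _Respects_)
open import Relation.Binary.PropositionalEquality using (_≡_; _≢_; refl; sym; trans; cong; subst; setoid; module ≡-Reasoning)

-- Let H be the pointwise stabiliser of the points labelled so far, with |H| ≤ k!, and
-- let O be the H-orbit of a point y still to be labelled. If |O| ≤ k, give the points of
-- O pairwise distinct labels: a label-preserving element of H maps O to itself, hence
-- fixes it pointwise, and so lies in the stabiliser of O, of order at most k!. If
-- |O| > k, orbit–stabiliser gives |H_y| ≤ |H| / |O| ≤ k! / k = (k-1)!, so y receives a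
-- label of its own and the remaining points are labelled for H_y with k - 1 labels; for
-- k = 1 this case cannot occur, as |O| ≤ |H| ≤ 1.

m*n≤[1+k]!⇒m≤k! : ∀ {m n} k → suc k ≤ n → m * n ≤ suc k ! → m ≤ k !
m*n≤[1+k]!⇒m≤k! {m} {n} k 1+k≤n mn≤[1+k]! = *-cancelˡ-≤ (suc k) (begin
  suc k * m ≡⟨ *-comm (suc k) m ⟩
  m * suc k ≤⟨ *-monoʳ-≤ m 1+k≤n ⟩
  m * n     ≤⟨ mn≤[1+k]! ⟩
  suc k !   ∎)
  where open ≤-Reasoning

module _ {a} {A : Set a} (_≟ᴬ_ : DecidableEquality A) where

  unique-⊆⇒length≤ : ∀ {xs ys : List A} → Unique xs → xs ⊆ ys → length xs ≤ length ys
  unique-⊆⇒length≤ {[]}     _                     _     = z≤n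
  unique-⊆⇒length≤ {x ∷ xs} {ys} (x∉xs ∷ xs-unique) xs⊆ys =
    ≤-trans (s≤s (unique-⊆⇒length≤ xs-unique xs⊆ys-x))
            (filter-notAll (x ≢?_) ys (Any.map (λ x≡y x≢y → x≢y x≡y) (xs⊆ys (here refl))))
    where
    _≢?_ : ∀ u → Decidable (u ≢_)
    u ≢? v = ¬? (u ≟ᴬ v)

    xs⊆ys-x : xs ⊆ filter (x ≢?_) ys
    xs⊆ys-x z∈xs = ∈-filter⁺ (x ≢?_) (xs⊆ys (there z∈xs)) (All.lookup x∉xs z∈xs)

module _ {N p} {P : Pred (Fin N) p} (P? : Decidable P) where

  satisfying : List (Fin N)
  satisfying = filter P? (allFin N)

  satisfying-unique : Unique satisfying
  satisfying-unique = Unique.filter⁺ P? (Unique.allFin⁺ N)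

  ∈-satisfying⁺ : ∀ {i} → P i → i ∈ satisfying
  ∈-satisfying⁺ {i} = ∈-filter⁺ P? (∈-allFin i)

  ∈-satisfying⁻ : ∀ {i} → i ∈ satisfying → P i
  ∈-satisfying⁻ i∈ = proj₂ (∈-filter⁻ P? {xs = allFin N} i∈)

  count : ℕ
  count = length satisfying

  count≤ : count ≤ N
  count≤ = ≤-trans (length-filter P? (allFin N)) (≤-reflexive (length-tabulate id))

  count-pos : ∀ {i} → P i → 1 ≤ count
  count-pos Pi = unique-⊆⇒length≤ _≟_ ([] ∷ []) λ { (here refl) → ∈-satisfying⁺ Pi }

module _ {N p q} {P : Pred (Fin N) p} {Q : Pred (Fin N) q}
         (P? : Decidable P) (Q? : Decidable Q) where

  count-injective : ∀ {f : Fin N → Fin N} → Injective _≡_ _≡_ f →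
                    (∀ {i} → P i → Q (f i)) → count P? ≤ count Q?
  count-injective {f} f-injective P⇒Q∘f = begin
    count P?                       ≡⟨ sym (length-map f (satisfying P?)) ⟩
    length (map f (satisfying P?)) ≤⟨ unique-⊆⇒length≤ _≟_ image-unique image⊆ ⟩
    count Q?                       ∎
    where
    open ≤-Reasoning
    image-unique : Unique (map f (satisfying P?))
    image-unique = Unique.map⁺ f-injective (satisfying-unique P?)

    image⊆ : map f (satisfying P?) ⊆ satisfying Q?
    image⊆ j∈ with i , i∈ , refl ← ∈-map⁻ f j∈ = ∈-satisfying⁺ Q? (P⇒Q∘f (∈-satisfying⁻ P? i∈))

  count-mono : (∀ {i} → P i → Q i) → count P? ≤ count Q?
  count-mono = count-injective id

module _ {N p q r} {P : Pred (Fin N) p} {Q : Pred (Fin N) q} {R : Pred (Fin N) r}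
         (P? : Decidable P) (Q? : Decidable Q) (R? : Decidable R) where

  count-disjoint : (∀ {i} → P i → Q i → ⊥) → (∀ {i} → P i → R i) → (∀ {i} → Q i → R i) →
                   count P? + count Q? ≤ count R?
  count-disjoint P∩Q≡∅ P⇒R Q⇒R = begin
    count P? + count Q?                        ≡⟨ sym (length-++ (satisfying P?)) ⟩
    length (satisfying P? ++ satisfying Q?)    ≤⟨ unique-⊆⇒length≤ _≟_ union-unique union⊆ ⟩
    count R?                                   ∎
    where
    open ≤-Reasoning
    union-unique : Unique (satisfying P? ++ satisfying Q?)
    union-unique = Unique.++⁺ (satisfying-unique P?) (satisfying-unique Q?)
      λ (i∈P , i∈Q) → P∩Q≡∅ (∈-satisfying⁻ P? i∈P) (∈-satisfying⁻ Q? i∈Q)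

    union⊆ : satisfying P? ++ satisfying Q? ⊆ satisfying R?
    union⊆ i∈ with ∈-++⁻ (satisfying P?) i∈
    ... | inj₁ i∈P = ∈-satisfying⁺ R? (P⇒R (∈-satisfying⁻ P? i∈P))
    ... | inj₂ i∈Q = ∈-satisfying⁺ R? (Q⇒R (∈-satisfying⁻ Q? i∈Q))

module Enumeration {c ℓ} (Γ : Group c ℓ) {n : ℕ} (order : HasOrder Γ n) where
  open Group Γ using (Carrier; _≈_; _∙_)
  module Γ = Group Γ
  open Inverse order using (to; from; from-cong; strictlyInverseˡ; strictlyInverseʳ)
  open import Algebra.Properties.Group Γ using (∙-cancelˡ)

  # : ∀ {p} {P : Pred Carrier p} → Decidable P → ℕ
  # P? = count (P? ∘ to)

  #≤order : ∀ {p} {P : Pred Carrier p} (P? : Decidable P) → # P? ≤ n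
  #≤order P? = count≤ (P? ∘ to)

  #-mono : ∀ {p q} {P : Pred Carrier p} {Q : Pred Carrier q} (P? : Decidable P) (Q? : Decidable Q) →
           (∀ {g} → P g → Q g) → # P? ≤ # Q?
  #-mono P? Q? P⇒Q = count-mono (P? ∘ to) (Q? ∘ to) P⇒Q

  #-disjoint : ∀ {p q r} {P : Pred Carrier p} {Q : Pred Carrier q} {R : Pred Carrier r}
               (P? : Decidable P) (Q? : Decidable Q) (R? : Decidable R) →
               (∀ {g} → P g → Q g → ⊥) → (∀ {g} → P g → R g) → (∀ {g} → Q g → R g) →
               # P? + # Q? ≤ # R?
  #-disjoint P? Q? R? P∩Q≡∅ P⇒R Q⇒R = count-disjoint (P? ∘ to) (Q? ∘ to) (R? ∘ to) P∩Q≡∅ P⇒R Q⇒R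

  #-pos : ∀ {p} {P : Pred Carrier p} (P? : Decidable P) → P Respects _≈_ → ∀ {g} → P g → 1 ≤ # P?
  #-pos P? P-resp {g} Pg = count-pos (P? ∘ to) (P-resp (Γ.sym (strictlyInverseˡ g)) Pg)

  #-translate : ∀ {p q} {P : Pred Carrier p} {Q : Pred Carrier q} (P? : Decidable P) (Q? : Decidable Q) →
                Q Respects _≈_ → ∀ h → (∀ {g} → P g → Q (h ∙ g)) → # P? ≤ # Q?
  #-translate P? Q? Q-resp h P⇒Q∘h∙ =
    count-injective (P? ∘ to) (Q? ∘ to) translate-injective
      (λ {i} Pi → Q-resp (Γ.sym (strictlyInverseˡ (h ∙ to i))) (P⇒Q∘h∙ Pi))
    where
    translate-injective : Injective _≡_ _≡_ (λ i → from (h ∙ to i))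
    translate-injective {i} {j} eq = begin
      i              ≡⟨ sym (strictlyInverseʳ i) ⟩
      from (to i)    ≡⟨ from-cong (∙-cancelˡ h (to i) (to j) h∙i≈h∙j) ⟩
      from (to j)    ≡⟨ strictlyInverseʳ j ⟩
      j              ∎
      where
      open ≡-Reasoning
      h∙i≈h∙j : h ∙ to i ≈ h ∙ to j
      h∙i≈h∙j = Γ.trans (Γ.sym (strictlyInverseˡ _)) (Γ.trans (Γ.reflexive (cong to eq)) (strictlyInverseˡ _))

  ∃? : ∀ {p} {P : Pred Carrier p} → Decidable P → P Respects _≈_ → Dec (∃ P)
  ∃? P? P-resp = map′ (λ (i , Pi) → to i , Pi) (λ (g , Pg) → from g , P-resp (Γ.sym (strictlyInverseˡ g)) Pg) (any? (P? ∘ to))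

module PointwiseStabiliser {c ℓ} {Γ : Group c ℓ} {m : ℕ} (A : Action Γ (Fin m)) where
  open Group Γ using (Carrier; _≈_; _∙_; ε; _⁻¹; inverseˡ)
  open Action A

  act-⁻¹ : ∀ g y → act (g ⁻¹) (act g y) ≡ y
  act-⁻¹ g y = begin
    act (g ⁻¹) (act g y) ≡⟨ sym (act-comp (g ⁻¹) g y) ⟩
    act (g ⁻¹ ∙ g) y     ≡⟨ act-cong (inverseˡ g) y ⟩
    act ε y              ≡⟨ act-id y ⟩
    y                    ∎
    where open ≡-Reasoning

  act-injective : ∀ g {u v} → act g u ≡ act g v → u ≡ v
  act-injective g {u} {v} eq = trans (sym (act-⁻¹ g u)) (trans (cong (act (g ⁻¹)) eq) (act-⁻¹ g v))

  Fixes : List (Fin m) → Pred Carrier 0ℓ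
  Fixes T g = All (λ t → act g t ≡ t) T

  fixes? : ∀ T → Decidable (Fixes T)
  fixes? T g = all? (λ t → act g t ≟ t) T

  Fixes-resp : ∀ {T} → Fixes T Respects _≈_
  Fixes-resp g≈h = All.map (trans (sym (act-cong g≈h _)))

  Fixes-ε : ∀ T → Fixes T ε
  Fixes-ε T = All.tabulate (λ {t} _ → act-id t)

  Fixes-∙ : ∀ {T g h} → Fixes T g → Fixes T h → Fixes T (g ∙ h)
  Fixes-∙ {g = g} {h} gT hT = All.zipWith (λ {t} (gt≡t , ht≡t) → begin
    act (g ∙ h) t   ≡⟨ act-comp g h t ⟩
    act g (act h t) ≡⟨ cong (act g) ht≡t ⟩
    act g t         ≡⟨ gt≡t ⟩
    t               ∎) (gT , hT)
    where open ≡-Reasoning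

  Fixes-⁻¹ : ∀ {T g} → Fixes T g → Fixes T (g ⁻¹)
  Fixes-⁻¹ {g = g} = All.map (λ {t} gt≡t → trans (cong (act (g ⁻¹)) (sym gt≡t)) (act-⁻¹ g t))

  MapsInto : ∀ {r} → List (Fin m) → Fin m → Pred (Fin m) r → Pred Carrier r
  MapsInto T y R g = Fixes T g × R (act g y)

  mapsInto? : ∀ {r} {R : Pred (Fin m) r} T y → Decidable R → Decidable (MapsInto T y R)
  mapsInto? T y R? g = fixes? T g ×-dec R? (act g y)

  MapsInto-resp : ∀ {r} {R : Pred (Fin m) r} {T y} → MapsInto T y R Respects _≈_
  MapsInto-resp {R = R} {y = y} g≈h (gT , Rgy) = Fixes-resp g≈h gT , subst R (act-cong g≈h y) Rgy

  Orbit : List (Fin m) → Fin m → Pred (Fin m) c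
  Orbit T y z = ∃ λ g → MapsInto T y (_≡ z) g

  Orbit-refl : ∀ {T y} → Orbit T y y
  Orbit-refl {T} {y} = ε , Fixes-ε T , act-id y

  Orbit-act : ∀ {T y z g} → Fixes T g → Orbit T y z → Orbit T y (act g z)
  Orbit-act {y = y} {g = g} gT (h , hT , refl) = g ∙ h , Fixes-∙ gT hT , act-comp g h y

  Orbit-act⁻ : ∀ {T y z g} → Fixes T g → Orbit T y (act g z) → Orbit T y z
  Orbit-act⁻ {z = z} {g} gT orb = subst (Orbit _ _) (act-⁻¹ g z) (Orbit-act (Fixes-⁻¹ gT) orb)

  Invariant : ∀ {p} → Pred (Fin m) p → Set (c ⊔ p)
  Invariant Y = ∀ g {y} → Y y → Y (act g y)

  InOrbit-invariant : ∀ x₀ → Invariant (InOrbit A x₀)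
  InOrbit-invariant x₀ g (h , refl) = g ∙ h , act-comp g h x₀

module OrbitStabiliser {c ℓ} {Γ : Group c ℓ} {n : ℕ} (order : HasOrder Γ n) {m : ℕ} (A : Action Γ (Fin m)) where
  open Group Γ using (_∙_)
  open Action A
  open Enumeration Γ order
  open PointwiseStabiliser A
  open import Data.List.Membership.DecPropositional (_≟_ {m}) using (_∈?_)

  orbit? : ∀ T y → Decidable (Orbit T y)
  orbit? T y z = ∃? (mapsInto? T y (_≟ z)) (MapsInto-resp {R = _≡ z})

  orbit : List (Fin m) → Fin m → List (Fin m)
  orbit T y = satisfying (orbit? T y)

  ∈-orbit⁺ : ∀ {T y z} → Orbit T y z → z ∈ orbit T y
  ∈-orbit⁺ {T} {y} = ∈-satisfying⁺ (orbit? T y)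

  ∈-orbit⁻ : ∀ {T y z} → z ∈ orbit T y → Orbit T y z
  ∈-orbit⁻ {T} {y} = ∈-satisfying⁻ (orbit? T y)

  #Stab : List (Fin m) → ℕ
  #Stab T = # (fixes? T)

  #Stab-++ : ∀ T T′ → #Stab (T ++ T′) ≤ #Stab T
  #Stab-++ T T′ = #-mono (fixes? (T ++ T′)) (fixes? T) (All.++⁻ˡ T)

  #Stab≤#fibre : ∀ {T y z} → Orbit T y z → #Stab (y ∷ T) ≤ # (mapsInto? T y (_≟ z))
  #Stab≤#fibre {T} {y} {z} (h , hT , hy≡z) =
    #-translate (fixes? (y ∷ T)) (mapsInto? T y (_≟ z)) (MapsInto-resp {R = _≡ z}) h
      λ { {g} (gy≡y ∷ gT) → Fixes-∙ {g = h} {g} hT gT , (begin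
        act (h ∙ g) y   ≡⟨ act-comp h g y ⟩
        act h (act g y) ≡⟨ cong (act h) gy≡y ⟩
        act h y         ≡⟨ hy≡z ⟩
        z               ∎) }
    where open ≡-Reasoning

  #MapsInto-∷ : ∀ {T y z Z} → z ∉ Z →
    # (mapsInto? T y (_≟ z)) + # (mapsInto? T y (_∈? Z)) ≤ # (mapsInto? T y (_∈? z ∷ Z))
  #MapsInto-∷ {T} {y} {z} {Z} z∉Z =
    #-disjoint (mapsInto? T y (_≟ z)) (mapsInto? T y (_∈? Z)) (mapsInto? T y (_∈? z ∷ Z))
      (λ (_ , gy≡z) (_ , gy∈Z) → z∉Z (subst (_∈ Z) gy≡z gy∈Z)) (Product.map₂ here) (Product.map₂ there)

  #Stab*length≤#MapsInto : ∀ {T y} Z → Unique Z → (∀ {z} → z ∈ Z → Orbit T y z) →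
    #Stab (y ∷ T) * length Z ≤ # (mapsInto? T y (_∈? Z))
  #Stab*length≤#MapsInto {T} {y} [] _ _ = ≤-trans (≤-reflexive (*-zeroʳ (#Stab (y ∷ T)))) z≤n
  #Stab*length≤#MapsInto {T} {y} (z ∷ Z) z∷Z-unique@(_ ∷ Z-unique) Z⊆orbit = begin
    #Stab (y ∷ T) * suc (length Z)                        ≡⟨ *-suc (#Stab (y ∷ T)) (length Z) ⟩
    #Stab (y ∷ T) + #Stab (y ∷ T) * length Z              ≤⟨ +-mono-≤ (#Stab≤#fibre (Z⊆orbit (here refl)))
                                                               (#Stab*length≤#MapsInto Z Z-unique (Z⊆orbit ∘ there)) ⟩
    # (mapsInto? T y (_≟ z)) + # (mapsInto? T y (_∈? Z))  ≤⟨ #MapsInto-∷ (Unique.Unique[x∷xs]⇒x∉xs z∷Z-unique) ⟩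
    # (mapsInto? T y (_∈? z ∷ Z))                         ∎
    where open ≤-Reasoning

  orbit-stabiliser : ∀ T y → #Stab (y ∷ T) * length (orbit T y) ≤ #Stab T
  orbit-stabiliser T y =
    ≤-trans (#Stab*length≤#MapsInto (orbit T y) (satisfying-unique (orbit? T y)) ∈-orbit⁻)
            (#-mono (mapsInto? T y (_∈? orbit T y)) (fixes? T) proj₁)

  length-orbit≤#Stab : ∀ T y → length (orbit T y) ≤ #Stab T
  length-orbit≤#Stab T y = begin
    length (orbit T y)                  ≡⟨ sym (*-identityˡ _) ⟩
    1 * length (orbit T y)              ≤⟨ *-monoˡ-≤ _ (#-pos (fixes? (y ∷ T)) Fixes-resp (Fixes-ε (y ∷ T))) ⟩
    #Stab (y ∷ T) * length (orbit T y)  ≤⟨ orbit-stabiliser T y ⟩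
    #Stab T                             ∎
    where open ≤-Reasoning

module _ {m k : ℕ} where
  open import Data.List.Membership.DecPropositional (_≟_ {m}) using (_∈?_)

  labelByPosition : (O : List (Fin m)) → length O ≤ k → (Fin m → Fin k) → Fin m → Fin k
  labelByPosition O ∣O∣≤k φ z with z ∈? O
  ... | yes z∈O = inject≤ (Any.index z∈O) ∣O∣≤k
  ... | no  _   = φ z

  labelByPosition-injective : ∀ {O} (∣O∣≤k : length O ≤ k) {φ z z′} → z ∈ O → z′ ∈ O →
    labelByPosition O ∣O∣≤k φ z ≡ labelByPosition O ∣O∣≤k φ z′ → z ≡ z′
  labelByPosition-injective {O} ∣O∣≤k {z = z} {z′} z∈O z′∈O eq with z ∈? O | z′ ∈? O
  ... | yes p | yes q = index-injective (setoid (Fin m)) p q (inject≤-injective ∣O∣≤k ∣O∣≤k _ _ eq)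
  ... | no z∉O | _    = contradiction z∈O z∉O
  ... | _ | no z′∉O   = contradiction z′∈O z′∉O

  labelByPosition-∉ : ∀ {O} (∣O∣≤k : length O ≤ k) {φ z} → z ∉ O → labelByPosition O ∣O∣≤k φ z ≡ φ z
  labelByPosition-∉ {O} _ {z = z} z∉O with z ∈? O
  ... | yes z∈O = contradiction z∈O z∉O
  ... | no  _   = refl

  withFreshLabel : Fin m → (Fin m → Fin k) → Fin m → Fin (suc k)
  withFreshLabel y φ z with z ≟ y
  ... | yes _ = fromℕ k
  ... | no  _ = inject₁ (φ z)

  withFreshLabel-≢ : ∀ {y φ z} → z ≢ y → withFreshLabel y φ z ≡ inject₁ (φ z)
  withFreshLabel-≢ {y} {z = z} z≢y with z ≟ y
  ... | yes z≡y = contradiction z≡y z≢y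
  ... | no  _   = refl

  withFreshLabel-fresh : ∀ {y φ z} → withFreshLabel y φ z ≡ withFreshLabel y φ y → z ≡ y
  withFreshLabel-fresh {y} {φ} {z} eq with z ≟ y
  ... | yes z≡y = z≡y
  ... | no  z≢y with y ≟ y
  ...   | yes _   = contradiction (sym eq) fromℕ≢inject₁
  ...   | no  y≢y = contradiction refl y≢y

module Distinguishing {c ℓ} {Γ : Group c ℓ} {n : ℕ} (order : HasOrder Γ n) {m : ℕ} (A : Action Γ (Fin m))
                      {p} {Y : Pred (Fin m) p} (Y-invariant : PointwiseStabiliser.Invariant A Y) where
  open Group Γ using (Carrier)
  open Action A
  open PointwiseStabiliser A
  open OrbitStabiliser order A
  open import Data.List.Membership.DecPropositional (_≟_ {m}) using (_∈?_)

  Preserves : ∀ {k} → (Fin m → Fin k) → Pred Carrier p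
  Preserves φ g = ∀ y → Y y → φ (act g y) ≡ φ y

  Distinguishes : ∀ {k} → List (Fin m) → List (Fin m) → (Fin m → Fin k) → Set (c ⊔ p)
  Distinguishes T L φ = ∀ g → Fixes T g → Preserves φ g → Fixes L g

  labelByPosition-distinguishes : ∀ {k T y L} → Y y → (∣O∣≤k : length (orbit T y) ≤ k) → ∀ {φ} →
    Distinguishes (T ++ orbit T y) L φ → Distinguishes T (y ∷ L) (labelByPosition (orbit T y) ∣O∣≤k φ)
  labelByPosition-distinguishes {k} {T} {y} Yy ∣O∣≤k {φ} φ-distinguishes g gT ψ-preserved =
    All.lookup fixes-O (∈-orbit⁺ Orbit-refl) ∷ φ-distinguishes g (All.++⁺ gT fixes-O) φ-preserved
    where
    O : List (Fin m)
    O = orbit T y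

    ψ : Fin m → Fin k
    ψ = labelByPosition O ∣O∣≤k φ

    ∈O⇒Y : ∀ {z} → z ∈ O → Y z
    ∈O⇒Y z∈O with h , _ , refl ← ∈-orbit⁻ z∈O = Y-invariant h Yy

    fixes-O : Fixes O g
    fixes-O = All.tabulate λ {z} z∈O →
      labelByPosition-injective ∣O∣≤k (∈-orbit⁺ (Orbit-act gT (∈-orbit⁻ z∈O))) z∈O (ψ-preserved z (∈O⇒Y z∈O))

    φ-preserved : Preserves φ g
    φ-preserved w Yw with w ∈? O
    ... | yes w∈O = cong φ (All.lookup fixes-O w∈O)
    ... | no  w∉O = begin
      φ (act g w) ≡⟨ sym (labelByPosition-∉ ∣O∣≤k gw∉O) ⟩
      ψ (act g w) ≡⟨ ψ-preserved w Yw ⟩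
      ψ w         ≡⟨ labelByPosition-∉ ∣O∣≤k w∉O ⟩
      φ w         ∎
      where
      open ≡-Reasoning
      gw∉O : act g w ∉ O
      gw∉O gw∈O = w∉O (∈-orbit⁺ (Orbit-act⁻ gT (∈-orbit⁻ gw∈O)))

  withFreshLabel-distinguishes : ∀ {k T y L} → Y y → ∀ {φ : Fin m → Fin k} →
    Distinguishes (y ∷ T) L φ → Distinguishes T (y ∷ L) (withFreshLabel y φ)
  withFreshLabel-distinguishes {k} {y = y} Yy {φ} φ-distinguishes g gT ψ-preserved =
    gy≡y ∷ φ-distinguishes g (gy≡y ∷ gT) φ-preserved
    where
    ψ : Fin m → Fin (suc k)
    ψ = withFreshLabel y φ

    gy≡y : act g y ≡ y
    gy≡y = withFreshLabel-fresh (ψ-preserved y Yy)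

    φ-preserved : Preserves φ g
    φ-preserved w Yw with w ≟ y
    ... | yes refl = cong φ gy≡y
    ... | no  w≢y  = inject₁-injective (begin
      inject₁ (φ (act g w)) ≡⟨ sym (withFreshLabel-≢ gw≢y) ⟩
      ψ (act g w)           ≡⟨ ψ-preserved w Yw ⟩
      ψ w                   ≡⟨ withFreshLabel-≢ w≢y ⟩
      inject₁ (φ w)         ∎)
      where
      open ≡-Reasoning
      gw≢y : act g w ≢ y
      gw≢y gw≡y = w≢y (act-injective g (trans gw≡y (sym gy≡y)))

  distinguishing : ∀ k T L → All Y L → #Stab T ≤ suc k ! → ∃ λ (φ : Fin m → Fin (suc k)) → Distinguishes T L φ
  distinguishing k T [] [] _ = (λ _ → zero) , λ _ _ _ → []
  distinguishing k T (y ∷ L) (Yy ∷ YL) #Stab≤k! with length (orbit T y) ≤? suc k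
  ... | yes ∣O∣≤k =
    Product.map (labelByPosition (orbit T y) ∣O∣≤k) (labelByPosition-distinguishes Yy ∣O∣≤k)
      (distinguishing k (T ++ orbit T y) L YL (≤-trans (#Stab-++ T (orbit T y)) #Stab≤k!))
  distinguishing zero T (y ∷ L) _ #Stab≤k! | no ∣O∣≰1 =
    contradiction (≤-trans (length-orbit≤#Stab T y) #Stab≤k!) ∣O∣≰1
  distinguishing (suc k) T (y ∷ L) (Yy ∷ YL) #Stab≤k! | no ∣O∣≰k =
    Product.map (withFreshLabel y) (withFreshLabel-distinguishes Yy)
      (distinguishing k (y ∷ T) L YL
        (m*n≤[1+k]!⇒m≤k! (suc k) (<⇒≤ (≰⇒> ∣O∣≰k)) (≤-trans (orbit-stabiliser T y) #Stab≤k!)))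

corollary2p13 : ∀ {c ℓ} (Γ : Group c ℓ) (n : ℕ) → HasOrder Γ n →
                (m : ℕ) (A : Action Γ (Fin m)) →
                (k : ℕ) → 1 ≤ k → n ≤ k ! →
                (x₀ : Fin m) → DistNumberOrbit≤ A x₀ k
corollary2p13 Γ n order m A zero    ()  n≤k! x₀
corollary2p13 Γ n order m A (suc k) _   n≤k! x₀ =
  Product.map₂ (λ φ-distinguishes g φ-preserved y y∈Γx₀ →
                  All.lookup (φ-distinguishes g [] φ-preserved) (Γx₀⊆orbit y∈Γx₀))
    (distinguishing k [] (orbit [] x₀) orbit⊆Γx₀ (≤-trans (#≤order (fixes? [])) n≤k!))
  where
  open Enumeration Γ order using (#≤order)
  open PointwiseStabiliser A
  open OrbitStabiliser order A
  open Distinguishing order A (InOrbit-invariant x₀)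

  orbit⊆Γx₀ : All (InOrbit A x₀) (orbit [] x₀)
  orbit⊆Γx₀ = All.tabulate (Product.map₂ proj₂ ∘ ∈-orbit⁻)

  Γx₀⊆orbit : ∀ {y} → InOrbit A x₀ y → y ∈ orbit [] x₀
  Γx₀⊆orbit y∈Γx₀ = ∈-orbit⁺ (Product.map₂ ([] ,_) y∈Γx₀)
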